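{- For every finite $S$-tree $(T,\alpha)$ over a set $\mathcal F$ of stars there is an essential $S$-tree $(T',\alpha')$ over the essential core of $\mathcal F$ such that $T'$ is a minor of $T$ (whose edges are edges of $T$) and $\alpha'=\alpha\restriction\vec E(T')$.
   Context: A separation system $(\vec S,\le,{}^*)$ is a poset with an order-reversing involution; write $\overleftarrow s=\vec s^{\,*}$. $\vec r$ is trivial (in $\vec S$) if there is a separation $\{\vec s,\overleftarrow s\}$ with $\vec r<\vec s$ and $\vec r<\overleftarrow s$. A star is a set $\sigma$ of nondegenerate ($\vec s\ne\overleftarrow s$) elements with $\vec r\le\overleftarrow s$ for all distinct $\vec r,\vec s\in\sigma$. The essential core of $\mathcal F\subseteq 2^{\vec S}$ is the set of all sets obtained from some $F\in\mathcal F$ by deleting its trivial elements. For a tree $T$, $\vec E(T)=\{(x,y):xy\in E(T)\}$, $\vec F_t=\{(x,t):xt\in E(T)\}$. An $S$-tree is a pair $(T,\alpha)$ with $\alpha:\vec E(T)\to\vec S$, $\alpha(y,x)=\alpha(x,y)^*$; over $\mathcal F$ if $\alpha(\vec F_t)\in\mathcal F$ for all nodes $t$; irredundant if no node $t$ has distinct neighbours $t',t''$ with $\alpha(t,t')=\alpha(t,t'')$; tight if no $\alpha(\vec F_t)$ contains both $\vec s$ and $\overleftarrow s$ with $\vec s\ne\overleftarrow s$; essential if irredundant, tight, and $\alpha(\vec E(T))$ contains no trivial element of $\vec S$. -}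

module Defs where

open import Level using (0ℓ)
open import Data.Bool using (Bool; true; false; T)
open import Data.Nat using (ℕ) renaming (_≤_ to _≤ℕ_)
open import Data.Fin using (Fin)
open import Data.Maybe using (Maybe; just; nothing)
open import Data.List using (List; []; _∷_; _++_; [_]; length)
open import Data.List.Relation.Unary.Linked using (Linked)
open import Data.List.Relation.Unary.Unique.Propositional using (Unique)
open import Data.Product using (Σ; ∃; ∃-syntax; _×_; _,_)
open import Relation.Nullary using (¬_)
open import Data.Unit using (⊤)
open import Relation.Unary using (Pred)
open import Relation.Binary using (Rel; IsPartialOrder)
open import Relation.Binary.PropositionalEquality using (_≡_; _≢_)
open import Function.Bundles using (_⇔_)

record SeparationSystem : Set₁ where
  field
    Sep       : Set
    _≤_       : Rel Sep 0ℓ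
    isPartialOrder : IsPartialOrder _≡_ _≤_
    _*        : Sep → Sep
    involutive : ∀ s → (s *) * ≡ s
    order-reversing : ∀ {r s} → r ≤ s → (s *) ≤ (r *)

  _<_ : Rel Sep 0ℓ
  r < s = (r ≤ s) × (r ≢ s)

  Trivial : Sep → Set
  Trivial r = ∃[ s ] ((r < s) × (r < (s *)))

  Nondegenerate : Sep → Set
  Nondegenerate s = s ≢ (s *)

  IsStar : Pred Sep 0ℓ → Set
  IsStar σ = (∀ s → σ s → Nondegenerate s)
           × (∀ r s → σ r → σ s → r ≢ s → r ≤ (s *))

  _≐_ : Pred Sep 0ℓ → Pred Sep 0ℓ → Set
  X ≐ Y = ∀ s → X s ⇔ Y s

  EssentialCore : Pred (Pred Sep 0ℓ) 0ℓ → Pred (Pred Sep 0ℓ) (Level.suc 0ℓ)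
  EssentialCore 𝓕 X = ∃[ F ] (𝓕 F × (∀ s → X s ⇔ (F s × ¬ Trivial s)))

  -- membership of a set of separations in a family of such sets
  -- (up to extensional equality, since subsets are predicates)
  _∈ᶠ_ : ∀ {ℓ} → Pred Sep 0ℓ → Pred (Pred Sep 0ℓ) ℓ → Set (Level.suc 0ℓ Level.⊔ ℓ)
  X ∈ᶠ 𝓕 = ∃[ F ] (𝓕 F × (F ≐ X))

record Graph (n : ℕ) : Set where
  field
    adj   : Fin n → Fin n → Bool
    adj-sym  : ∀ x y → adj x y ≡ adj y x
    adj-irrefl : ∀ x → adj x x ≡ false

  Edge : Fin n → Fin n → Set
  Edge x y = T (adj x y)

open Graph public

data WalkIn {n} (G : Graph n) (P : Pred (Fin n) 0ℓ) : Fin n → Fin n → Set where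
  here : ∀ {x} → P x → WalkIn G P x x
  step : ∀ {x y z} → P x → Edge G x y → WalkIn G P y z → WalkIn G P x z

ConnectedIn : ∀ {n} → Graph n → Pred (Fin n) 0ℓ → Set
ConnectedIn G P = ∀ x y → P x → P y → WalkIn G P x y

HasCycle : ∀ {n} → Graph n → Set
HasCycle G = ∃[ v ] ∃[ ws ] ((2 ≤ℕ length ws)
             × Unique (v ∷ ws)
             × Linked (Edge G) (v ∷ ws ++ [ v ]))

IsTree : ∀ {n} → Graph n → Set
IsTree {n} G = Fin n × ConnectedIn G (λ _ → ⊤) × ¬ HasCycle G

record Tree : Set where
  field
    size  : ℕ
    graph : Graph size
    isTree : IsTree graph

module _ (𝕊 : SeparationSystem) where
  open SeparationSystem 𝕊

  -- α is given on all ordered pairs of nodes; only its values on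
  -- oriented edges (x , y) with xy ∈ E(T) are relevant.
  record STree : Set where
    field
      tree : Tree
    open Tree tree public
    field
      α : Fin size → Fin size → Sep
      α-flip : ∀ x y → Edge graph x y → α y x ≡ (α x y) *

  module _ (τ : STree) where
    open STree τ

    αF : Fin size → Pred Sep 0ℓ
    αF t s = ∃[ x ] (Edge graph x t × α x t ≡ s)

    OverSTree : ∀ {ℓ} → Pred (Pred Sep 0ℓ) ℓ → Set (Level.suc 0ℓ Level.⊔ ℓ)
    OverSTree 𝓕 = ∀ t → αF t ∈ᶠ 𝓕

    Irredundant : Set
    Irredundant = ¬ (∃[ t ] ∃[ t' ] ∃[ t'' ] (t' ≢ t'' × Edge graph t t'
                     × Edge graph t t'' × α t t' ≡ α t t''))

    Tight : Set
    Tight = ¬ (∃[ t ] ∃[ s ] (αF t s × αF t (s *) × s ≢ (s *)))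

    Essential : Set
    Essential = Irredundant × Tight
              × (∀ x y → Edge graph x y → ¬ Trivial (α x y))

-- A minor model of T' in T: a partial map β from nodes of T onto nodes of T'
-- (nodes mapped to nothing are deleted) whose fibres (branch sets) are
-- connected in T, together with an assignment ε sending each edge t₁t₂ of T'
-- to an oriented edge (x , y) of T with x ∈ β⁻¹(t₁), y ∈ β⁻¹(t₂).
record MinorWithEdges (T' T : Tree) : Set where
  private
    module T  = Tree T
    module T' = Tree T'
  field
    β       : Fin T.size → Maybe (Fin T'.size)
    β-onto  : ∀ t → ∃[ x ] (β x ≡ just t)
    β-conn  : ∀ t → ConnectedIn T.graph (λ x → β x ≡ just t)
    εˢ εᵗ   : Fin T'.size → Fin T'.size → Fin T.size
    ε-edge  : ∀ t₁ t₂ → Edge T'.graph t₁ t₂ →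
              Edge T.graph (εˢ t₁ t₂) (εᵗ t₁ t₂)
              × β (εˢ t₁ t₂) ≡ just t₁ × β (εᵗ t₁ t₂) ≡ just t₂

module Submission where

-- The proof is by well-founded induction on the number of nodes.  The
-- invariant is that the tree is over 𝓕 up to trivial separations: every
-- α(F⃗ₜ) agrees with some F ∈ 𝓕 on all nontrivial separations.  A tree with
-- this property that is not essential admits one of three reductions, each
-- producing a strictly smaller minor with inherited labels and the invariant:
--   * an edge with a trivial label:       delete the branch behind it;
--   * a redundant node t, α(t,t') = α(t,t''):  delete the branch at t';
--   * a non-tight node t, s and s* in α(F⃗ₜ): since α(F⃗ₜ) is a star up to
--     trivial elements, t has exactly the two neighbours sending s and s*,
--     and t is suppressed by contracting one of its two edges.
-- A tree admitting no reduction is itself the required essential tree.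

open import Defs
open import Level using (0ℓ)
open import Axiom.ExcludedMiddle using (ExcludedMiddle)
open import Data.Bool using (Bool; true; false; T; _∨_)
open import Data.Bool.Properties using (T-∨)
open import Data.Empty using (⊥-elim)
open import Data.Fin using (Fin) renaming (_≟_ to _≟ᶠ_)
open import Data.List using (List; []; _∷_; _++_; [_]; length; filter; allFin; lookup)
open import Data.List.Properties using (filter-notAll; length-tabulate)
open import Data.List.Membership.Propositional using (_∈_)
open import Data.List.Membership.Propositional.Properties using (∈-filter⁺; ∈-filter⁻; ∈-lookup; ∈-allFin)
open import Data.List.Relation.Unary.All using (All; []; _∷_)
import Data.List.Relation.Unary.All as All
open import Data.List.Relation.Unary.AllPairs using ([]; _∷_)
open import Data.List.Relation.Unary.Any using (here; there)
import Data.List.Relation.Unary.Any as Any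
open import Data.List.Relation.Unary.Any.Properties using (lookup-index)
open import Data.List.Relation.Unary.Linked using (Linked; [-]; _∷_)
open import Data.List.Relation.Unary.Unique.Propositional using (Unique)
open import Data.List.Relation.Unary.Unique.Propositional.Properties using (allFin⁺; filter⁺)
open import Data.Maybe using (Maybe; just; nothing; _>>=_)
open import Data.Nat using (ℕ; s≤s; z≤n) renaming (_≤_ to _≤ℕ_; _<_ to _<ℕ_)
open import Data.Nat.Induction using (<-wellFounded)
open import Data.Product using (Σ; ∃-syntax; _×_; _,_; proj₁; proj₂)
open import Data.Sum using (_⊎_; inj₁; inj₂)
open import Data.Unit using (⊤; tt)
open import Function.Bundles using (Equivalence; mk⇔)
open import Induction.WellFounded using (Acc; acc)
open import Relation.Binary.PropositionalEquality using (_≡_; _≢_; refl; sym; trans; cong; cong₂; subst; subst₂)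
open import Relation.Nullary using (¬_; Dec; yes; no)
open import Relation.Nullary.Decidable using (isYes; isYes≗does; does-⇔; dec-false; toWitness; fromWitness; T?; ¬?; _×-dec_; _⊎-dec_)
open import Relation.Unary using (Pred)

≢-sym : ∀ {A : Set} {a b : A} → a ≢ b → b ≢ a
≢-sym a≢b b≡a = a≢b (sym b≡a)

module _ {n : ℕ} (G : Graph n) where

  edge-sym : ∀ {x y} → Edge G x y → Edge G y x
  edge-sym {x} {y} = subst T (adj-sym G x y)

  edge-irrefl : ∀ {x y} → Edge G x y → x ≢ y
  edge-irrefl {x} e refl = subst T (adj-irrefl G x) e

mapʷ : ∀ {n} {G : Graph n} {P Q : Pred (Fin n) 0ℓ} →
       (∀ {z} → P z → Q z) → ∀ {x y} → WalkIn G P x y → WalkIn G Q x y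
mapʷ f (here p)     = here (f p)
mapʷ f (step p e w) = step (f p) e (mapʷ f w)

module Walk {n : ℕ} {G : Graph n} {P : Pred (Fin n) 0ℓ} where

  vertices : ∀ {x y} → WalkIn G P x y → List (Fin n)
  vertices (here {x} _)     = x ∷ []
  vertices (step {x} _ _ w) = x ∷ vertices w

  all-vertices : ∀ {x y} (w : WalkIn G P x y) → All P (vertices w)
  all-vertices (here p)     = p ∷ []
  all-vertices (step p _ w) = p ∷ all-vertices w

  first : ∀ {x y} → WalkIn G P x y → P x
  first (here p)     = p
  first (step p _ _) = p

  last : ∀ {x y} → WalkIn G P x y → P y
  last (here p)     = p
  last (step _ _ w) = last w

  _++ʷ_ : ∀ {x y z} → WalkIn G P x y → WalkIn G P y z → WalkIn G P x z
  here _       ++ʷ w' = w'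
  step p e w   ++ʷ w' = step p e (w ++ʷ w')

  reverse : ∀ {x y} → WalkIn G P x y → WalkIn G P y x
  reverse (here p)     = here p
  reverse (step p e w) = reverse w ++ʷ step (first w) (edge-sym G e) (here p)

  suffix : ∀ {x y} (w : WalkIn G P x y) {v} → v ∈ vertices w →
           Σ (WalkIn G P v y) λ w' → Unique (vertices w) → Unique (vertices w')
  suffix (here p)     (here refl) = here p , λ u → u
  suffix (step p e w) (here refl) = step p e w , λ u → u
  suffix (step p e w) (there v∈w) with suffix w v∈w
  ... | w' , unique = w' , λ { (_ ∷ u) → unique u }

  open import Data.List.Membership.DecPropositional (_≟ᶠ_ {n}) using (_∈?_)

  to-path : ∀ {x y} (w : WalkIn G P x y) → Σ (WalkIn G P x y) λ w' → Unique (vertices w')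
  to-path (here p) = here p , [] ∷ []
  to-path (step {x} p e w) with to-path w
  ... | w' , unique with x ∈? vertices w'
  ...   | yes x∈w' = let (w'' , shorten) = suffix w' x∈w' in w'' , shorten unique
  ...   | no  x∉w' = step p e w' , All.tabulate (λ z∈w' x≡z → x∉w' (subst (_∈ vertices w') (sym x≡z) z∈w')) ∷ unique

open Walk using (_++ʷ_)

-- Detours

-- A graph has a cycle iff it has a
-- detour (inside all vertices); detours are what the tree constructions
-- below manipulate, cycles are what the definition of a tree speaks about.
DetourIn : ∀ {n} → Graph n → Pred (Fin n) 0ℓ → Set
DetourIn {n} G K = Σ (Fin n) λ b → Σ (Fin n) λ u → Σ (Fin n) λ a →
  K b × u ≢ a × Edge G b u × Edge G b a × WalkIn G (λ z → K z × z ≢ b) u a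

Detour : ∀ {n} → Graph n → Set
Detour G = DetourIn G (λ _ → ⊤)

module _ {n : ℕ} {G : Graph n} where
  open Walk

  linked : ∀ {P x y c} (w : WalkIn G P x y) → Edge G y c → Linked (Edge G) (vertices w ++ [ c ])
  linked (here p) e = e ∷ [-]
  linked (step p e (here q)) e' = e ∷ e' ∷ [-]
  linked (step p e (step q e₁ w)) e' = e ∷ linked (step q e₁ w) e'

  -- a detour closed through b, with its walk shortened to a path, is a cycle
  detour→cycle : Detour G → HasCycle G
  detour→cycle (b , u , a , _ , u≢a , ebu , eba , w) with to-path (mapʷ proj₂ w)
  ... | here p , _ = ⊥-elim (u≢a refl)
  ... | step p e w' , unique =
    b , vertices (step p e w') , s≤s (nonempty w') ,
    All.map ≢-sym (all-vertices (step p e w')) ∷ unique ,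
    ebu ∷ linked (step p e w') (edge-sym G eba)
    where
    nonempty : ∀ {Q x y} (w : WalkIn G Q x y) → 1 ≤ℕ length (vertices w)
    nonempty (here _)     = s≤s z≤n
    nonempty (step _ _ _) = s≤s z≤n

  private
    cycle-walk : ∀ v x (xs : List (Fin n)) → All (_≢ v) (x ∷ xs) →
                 Linked (Edge G) (x ∷ xs ++ [ v ]) →
                 Σ (Fin n) λ a → WalkIn G (λ z → ⊤ × z ≢ v) x a × Edge G a v × a ∈ (x ∷ xs)
    cycle-walk v x []       (x≢v ∷ []) (e ∷ [-]) = x , here (tt , x≢v) , e , here refl
    cycle-walk v x (y ∷ xs) (x≢v ∷ ys≢v) (e ∷ l) with cycle-walk v y xs ys≢v l
    ... | a , w , e' , a∈ = a , step (tt , x≢v) e w , e' , there a∈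

  -- a cycle v w₁ w₂ … w_k gives a detour at v from w₁ to w_k via w₂
  cycle→detour : HasCycle G → Detour G
  cycle→detour (v , (w₁ ∷ []) , s≤s () , _)
  cycle→detour (v , (w₁ ∷ w₂ ∷ ws) , _ , ((v≢w₁ ∷ v≢ws) ∷ (w₁≢ws ∷ _)) , (e ∷ e₂ ∷ l))
    with cycle-walk v w₂ ws (All.map ≢-sym v≢ws) l
  ... | a , w , e' , a∈ =
    v , w₁ , a , tt , (λ w₁≡a → All.lookup w₁≢ws a∈ w₁≡a) , e , edge-sym G e' ,
    step (tt , ≢-sym v≢w₁) e₂ w

tree-no-detour : (T : Tree) → ¬ Detour (Tree.graph T)
tree-no-detour T d = proj₂ (proj₂ (Tree.isTree T)) (detour→cycle d)

lookup-injective : ∀ {A : Set} {xs : List A} → Unique xs →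
                   ∀ i j → lookup xs i ≡ lookup xs j → i ≡ j
lookup-injective {xs = _ ∷ _} (_ ∷ _)   Fin.zero    Fin.zero    _  = refl
lookup-injective {xs = _ ∷ _} (x∉ ∷ _)  Fin.zero    (Fin.suc j) eq = ⊥-elim (All.lookup x∉ (∈-lookup j) eq)
lookup-injective {xs = _ ∷ _} (x∉ ∷ _)  (Fin.suc i) Fin.zero    eq = ⊥-elim (All.lookup x∉ (∈-lookup i) (sym eq))
lookup-injective {xs = _ ∷ _} (_ ∷ u)   (Fin.suc i) (Fin.suc j) eq = cong Fin.suc (lookup-injective u i j eq)

-- This is how the node set of a minor is made a set of the form Fin m.
module Enumerate {n : ℕ} (k : Fin n → Bool) where

  K : Pred (Fin n) 0ℓ
  K z = T (k z)

  private
    elements : List (Fin n)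
    elements = filter (λ z → T? (k z)) (allFin n)

    K-elements : ∀ {z} → K z → z ∈ elements
    K-elements {z} kz = ∈-filter⁺ (λ z → T? (k z)) (∈-allFin z) kz

  m : ℕ
  m = length elements

  embed : Fin m → Fin n
  embed = lookup elements

  embed-K : ∀ i → K (embed i)
  embed-K i = proj₂ (∈-filter⁻ (λ z → T? (k z)) {xs = allFin n} (∈-lookup i))

  embed-injective : ∀ i j → embed i ≡ embed j → i ≡ j
  embed-injective = lookup-injective (filter⁺ (λ z → T? (k z)) (allFin⁺ n))

  index : ∀ z → K z → Fin m
  index z kz = Any.index (K-elements kz)

  embed-index : ∀ z (kz : K z) → embed (index z kz) ≡ z
  embed-index z kz = sym (lookup-index (K-elements kz))

  index-embed : ∀ i (kz : K (embed i)) → index (embed i) kz ≡ i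
  index-embed i kz = embed-injective _ _ (embed-index (embed i) kz)


  m<n : ∀ z → ¬ K z → m <ℕ n
  m<n z z∉K = subst (m <ℕ_) (length-tabulate (λ x → x))
    (filter-notAll (λ z → T? (k z)) (allFin n) (Any.map (λ { refl → z∉K }) (∈-allFin z)))

  restrict : Fin n → Maybe (Fin m)
  restrict z with T? (k z)
  ... | yes kz = just (index z kz)
  ... | no  _  = nothing

  restrict-embed : ∀ i → restrict (embed i) ≡ just i
  restrict-embed i with T? (k (embed i))
  ... | yes kz = cong just (index-embed i kz)
  ... | no ¬kz = ⊥-elim (¬kz (embed-K i))

  restrict-just : ∀ z i → restrict z ≡ just i → z ≡ embed i
  restrict-just z i eq with T? (k z)
  restrict-just z i refl | yes kz = sym (embed-index z kz)
  restrict-just z i ()   | no  _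

bind-just : ∀ {A B : Set} (ma : Maybe A) (f : A → Maybe B) {b} →
            (ma >>= f) ≡ just b → Σ A λ a → ma ≡ just a × f a ≡ just b
bind-just (just a) f eq = a , refl , eq
bind-just nothing  f ()

minor-refl : (T₀ : Tree) → MinorWithEdges T₀ T₀
minor-refl T₀ = record
  { β      = just
  ; β-onto = λ t → t , refl
  ; β-conn = λ { t x y refl refl → here refl }
  ; εˢ     = λ a b → a
  ; εᵗ     = λ a b → b
  ; ε-edge = λ a b e → e , refl , refl }

-- A minor of a minor is a minor: branch sets compose, and an edge of T₂ is
-- represented by the T₀-edge representing the T₁-edge that represents it.
module Compose {T₂ T₁ T₀ : Tree} (μ₂ : MinorWithEdges T₂ T₁) (μ₁ : MinorWithEdges T₁ T₀) where
  private
    module M₂ = MinorWithEdges μ₂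
    module M₁ = MinorWithEdges μ₁
    module T₀ = Tree T₀
    module T₁ = Tree T₁

  β : Fin T₀.size → Maybe (Fin (Tree.size T₂))
  β z = M₁.β z >>= M₂.β

  β-via : ∀ {z x t} → M₁.β z ≡ just x → M₂.β x ≡ just t → β z ≡ just t
  β-via {z} p q rewrite p = q

  -- a walk in a branch set of μ₂ lifts, through the branch sets of μ₁ and
  -- the T₀-edges representing its T₁-edges, to a walk in T₀
  lift : ∀ t {x₁ y₁} → WalkIn T₁.graph (λ a → M₂.β a ≡ just t) x₁ y₁ →
         ∀ x y → M₁.β x ≡ just x₁ → M₁.β y ≡ just y₁ →
         WalkIn T₀.graph (λ z → β z ≡ just t) x y
  lift t (here p) x y px py = mapʷ (λ q → β-via q p) (M₁.β-conn _ x y px py)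
  lift t (step {x₁} {a₁} p e w) x y px py =
    let (e₀ , pa , pb) = M₁.ε-edge x₁ a₁ e
        w₁ = mapʷ (λ q → β-via q p) (M₁.β-conn _ x _ px pa)
    in w₁ ++ʷ step (Walk.last w₁) e₀ (lift t w _ y pb py)

  compose : MinorWithEdges T₂ T₀
  compose = record
    { β      = β
    ; β-onto = λ t → let (x₁ , p₁) = M₂.β-onto t ; (x₀ , p₀) = M₁.β-onto x₁
                     in x₀ , β-via p₀ p₁
    ; β-conn = λ t x y px py →
        let (x₁ , qx , rx) = bind-just (M₁.β x) M₂.β px
            (y₁ , qy , ry) = bind-just (M₁.β y) M₂.β py
        in lift t (M₂.β-conn t x₁ y₁ rx ry) x y qx qy
    ; εˢ     = λ a b → M₁.εˢ (M₂.εˢ a b) (M₂.εᵗ a b)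
    ; εᵗ     = λ a b → M₁.εᵗ (M₂.εˢ a b) (M₂.εᵗ a b)
    ; ε-edge = λ a b e →
        let (e₁ , p₁ , q₁) = M₂.ε-edge a b e
            (e₀ , p₀ , q₀) = M₁.ε-edge _ _ e₁
        in e₀ , β-via p₀ p₁ , β-via q₀ q₁ }

open Compose using (compose)

-- The induced minor construction

-- Both operations on S-trees used in the reduction are instances of this:
-- from an auxiliary graph H on the nodes of T and a set K of nodes on which
-- H induces a tree, together with connected branch sets in T for the nodes of
-- K and T-edges representing the H-edges inside K, we obtain an S-tree on K
-- (with the labels of the representing edges) that is a minor of T.
module Induced (𝕊 : SeparationSystem) (τ : STree 𝕊) where
  open SeparationSystem 𝕊
  open STree τ renaming (size to n; graph to G)

  module _ (H : Graph n) (k : Fin n → Bool) where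
    open Enumerate k

    record MinorData : Set where
      field
        nonempty         : Σ (Fin n) K
        connected        : ConnectedIn H K
        no-detour        : ¬ DetourIn H K
        branch           : Fin n → Maybe (Fin n)
        branch-own       : ∀ w → K w → branch w ≡ just w
        branch-connected : ∀ w → K w → ConnectedIn G (λ z → branch z ≡ just w)
        εˢ εᵗ            : Fin n → Fin n → Fin n
        ε-edge           : ∀ p q → K p → K q → Edge H p q →
                           Edge G (εˢ p q) (εᵗ p q)
                           × branch (εˢ p q) ≡ just p × branch (εᵗ p q) ≡ just q
        ε-flip           : ∀ p q → K p → K q → Edge H p q →
                           εˢ q p ≡ εᵗ p q × εᵗ q p ≡ εˢ p q

    module Minor (d : MinorData) where
      open MinorData d

      H[K] : Graph m
      H[K] = record { adj        = λ i j → adj H (embed i) (embed j)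
                    ; adj-sym    = λ i j → adj-sym H (embed i) (embed j)
                    ; adj-irrefl = λ i → adj-irrefl H (embed i) }

      index-walk : ∀ {x y} (w : WalkIn H K x y) →
                   WalkIn H[K] (λ _ → ⊤) (index x (Walk.first w)) (index y (Walk.last w))
      index-walk (here p) = here tt
      index-walk (step {x} {y} p e w) =
        step tt (subst₂ (Edge H) (sym (embed-index x p)) (sym (embed-index y (Walk.first w))) e)
                (index-walk w)

      H[K]-connected : ConnectedIn H[K] (λ _ → ⊤)
      H[K]-connected i j _ _ =
        subst₂ (WalkIn H[K] (λ _ → ⊤)) (index-embed′ i) (index-embed′ j)
               (index-walk (connected (embed i) (embed j) (embed-K i) (embed-K j)))
        where
        index-embed′ : ∀ i {p} → index (embed i) p ≡ i
        index-embed′ i {p} = index-embed i p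

      -- a cycle in H[K] would be a detour of H inside K
      H[K]-acyclic : ¬ HasCycle H[K]
      H[K]-acyclic cycle with cycle→detour cycle
      ... | b , u , a , _ , u≢a , ebu , eba , w =
        no-detour (embed b , embed u , embed a , embed-K b ,
                   (λ eq → u≢a (embed-injective u a eq)) , ebu , eba , embed-walk w)
        where
        embed-walk : ∀ {x y} → WalkIn H[K] (λ z → ⊤ × z ≢ b) x y →
                     WalkIn H (λ z → K z × z ≢ embed b) (embed x) (embed y)
        embed-walk (here {x} (_ , x≢b)) = here (embed-K x , λ eq → x≢b (embed-injective _ _ eq))
        embed-walk (step {x} (_ , x≢b) e w) =
          step (embed-K x , λ eq → x≢b (embed-injective _ _ eq)) e (embed-walk w)

      minor-tree : Tree
      minor-tree = record { size   = m
                          ; graph  = H[K]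
                          ; isTree = index _ (proj₂ nonempty) , H[K]-connected , H[K]-acyclic }

      α′ : Fin m → Fin m → Sep
      α′ i j = α (εˢ (embed i) (embed j)) (εᵗ (embed i) (embed j))

      α′-flip : ∀ i j → Edge H[K] i j → α′ j i ≡ (α′ i j) *
      α′-flip i j e with ε-flip (embed i) (embed j) (embed-K i) (embed-K j) e
                       | ε-edge (embed i) (embed j) (embed-K i) (embed-K j) e
      ... | flipˢ , flipᵗ | e′ , _ rewrite flipˢ | flipᵗ = α-flip _ _ e′

      τ′ : STree 𝕊
      τ′ = record { tree = minor-tree ; α = α′ ; α-flip = α′-flip }

      β : Fin n → Maybe (Fin m)
      β z = branch z >>= restrict

      β-just : ∀ z i → β z ≡ just i → branch z ≡ just (embed i)
      β-just z i eq with bind-just (branch z) restrict eq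
      ... | w , bz , rw = trans bz (cong just (restrict-just w i rw))

      β-from : ∀ z i → branch z ≡ just (embed i) → β z ≡ just i
      β-from z i eq rewrite eq = restrict-embed i

      μ : MinorWithEdges minor-tree (STree.tree τ)
      μ = record
        { β      = β
        ; β-onto = λ i → embed i , β-from (embed i) i (branch-own (embed i) (embed-K i))
        ; β-conn = λ i x y px py → mapʷ (λ {z} → β-from z i)
                     (branch-connected (embed i) (embed-K i) x y (β-just x i px) (β-just y i py))
        ; εˢ     = λ i j → εˢ (embed i) (embed j)
        ; εᵗ     = λ i j → εᵗ (embed i) (embed j)
        ; ε-edge = λ i j e → let (e′ , bi , bj) = ε-edge (embed i) (embed j) (embed-K i) (embed-K j) e
                             in e′ , β-from _ i bi , β-from _ j bj }

      IncomingVia : Fin m → Pred Sep 0ℓ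
      IncomingVia i s = ∃[ z ] (K z × Edge H z (embed i) × α (εˢ z (embed i)) (εᵗ z (embed i)) ≡ s)

      αF′→ : ∀ i s → αF 𝕊 τ′ i s → IncomingVia i s
      αF′→ i s (j , e , eq) = embed j , embed-K j , e , eq

      αF′← : ∀ i s → IncomingVia i s → αF 𝕊 τ′ i s
      αF′← i s (z , kz , e , eq) rewrite sym (embed-index z kz) = index z kz , e , eq

-- Deleting a branch

-- For an edge ab of T keep the nodes reachable from a without passing
-- through b.  They induce a smaller subtree of T, and the separations
-- pointing to a kept node are those of T, except that a loses α(b,a).
module DeleteBranch (lem : ∀ {ℓ} → ExcludedMiddle ℓ) (𝕊 : SeparationSystem) (τ : STree 𝕊)
                    (a b : Fin (STree.size τ)) (eab : Edge (STree.graph τ) a b) where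
  open SeparationSystem 𝕊
  open STree τ renaming (size to n; graph to G)

  SideOfA : Pred (Fin n) 0ℓ
  SideOfA z = WalkIn G (_≢ b) z a

  k : Fin n → Bool
  k z = isYes (lem {P = SideOfA z})

  open Enumerate k public

  to-side : ∀ {z} → K z → SideOfA z
  to-side = toWitness

  from-side : ∀ {z} → SideOfA z → K z
  from-side = fromWitness

  side-walk : ∀ {z} → SideOfA z → WalkIn G K z a
  side-walk (here p)     = here (from-side (here p))
  side-walk (step p e w) = step (from-side (step p e w)) e (side-walk w)

  -- ab is the only edge leaving a's side, since T has no detour at b
  boundary : ∀ {z z′} → K z → Edge G z′ z → ¬ K z′ → z′ ≡ b × z ≡ a
  boundary {z} {z′} kz e z′∉K with z′ ≟ᶠ b
  ... | no z′≢b = ⊥-elim (z′∉K (from-side (step z′≢b e (to-side kz))))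
  ... | yes refl with z ≟ᶠ a
  ...   | yes z≡a = refl , z≡a
  ...   | no  z≢a = ⊥-elim (tree-no-detour tree
                      (b , z , a , tt , z≢a , e , edge-sym G eab , mapʷ (tt ,_) (to-side kz)))

  keep : Fin n → Maybe (Fin n)
  keep z with k z
  ... | true  = just z
  ... | false = nothing

  keep-own : ∀ w → K w → keep w ≡ just w
  keep-own w kw with k w | kw
  ... | true | _ = refl

  keep-just : ∀ z {w} → keep z ≡ just w → z ≡ w
  keep-just z eq with k z
  keep-just z refl | true = refl

  minor-data : Induced.MinorData 𝕊 τ G k
  minor-data = record
    { nonempty         = a , from-side (here (edge-irrefl G eab))
    ; connected        = λ x y kx ky → side-walk (to-side kx) ++ʷ Walk.reverse (side-walk (to-side ky))
    ; no-detour        = λ { (b′ , u , a′ , _ , u≢a′ , e₁ , e₂ , w) →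
                             tree-no-detour tree (b′ , u , a′ , tt , u≢a′ , e₁ , e₂ , mapʷ (λ p → tt , proj₂ p) w) }
    ; branch           = keep
    ; branch-own       = keep-own
    ; branch-connected = λ w _ x y px py →
        subst (λ r → WalkIn G (λ z → keep z ≡ just w) r y) (trans (keep-just y py) (sym (keep-just x px))) (here py)
    ; εˢ               = λ p q → p
    ; εᵗ               = λ p q → q
    ; ε-edge           = λ p q kp kq e → e , keep-own p kp , keep-own q kq
    ; ε-flip           = λ _ _ _ _ _ → refl , refl }

  open Induced.Minor 𝕊 τ G k minor-data public

  smaller : m <ℕ n
  smaller = m<n b (λ kb → Walk.first (to-side kb) refl)

  incoming⊆ : ∀ i s → αF 𝕊 τ′ i s → αF 𝕊 τ (embed i) s
  incoming⊆ i s p with αF′→ i s p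
  ... | z , _ , e , eq = z , e , eq

  incoming⊇ : ∀ i s → αF 𝕊 τ (embed i) s → αF 𝕊 τ′ i s ⊎ (embed i ≡ a × s ≡ α b a)
  incoming⊇ i s (z , e , eq) with T? (k z)
  ... | yes kz = inj₁ (αF′← i s (z , kz , e , eq))
  ... | no z∉K with boundary (embed-K i) e z∉K
  ...   | refl , i≡a = inj₂ (i≡a , sym (subst (λ r → α b r ≡ s) i≡a eq))

-- Suppressing a node of degree two

-- A node t whose only neighbours are x ≠ y is suppressed by contracting the
-- edge ty: the auxiliary graph H is T plus the new edge xy, the kept nodes
-- are those other than t, the branch set of y is {y, t}, and the new edge
-- is represented by the T-edge xt.  If α(x,t) = α(t,y), every node keeps
-- its set of incoming separations.
module Suppress (𝕊 : SeparationSystem) (τ : STree 𝕊) where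
  open SeparationSystem 𝕊
  open STree τ renaming (size to n; graph to G)

  module At (t x y : Fin n) (ext : Edge G x t) (eyt : Edge G y t) (x≢y : x ≢ y)
           (neighbours : ∀ w → Edge G w t → w ≡ x ⊎ w ≡ y) (αxt≡αty : α x t ≡ α t y) where

    NewEdge : Fin n → Fin n → Set
    NewEdge p q = (p ≡ x × q ≡ y) ⊎ (p ≡ y × q ≡ x)

    new? : ∀ p q → Dec (NewEdge p q)
    new? p q = ((p ≟ᶠ x) ×-dec (q ≟ᶠ y)) ⊎-dec ((p ≟ᶠ y) ×-dec (q ≟ᶠ x))

    new-sym : ∀ {p q} → NewEdge p q → NewEdge q p
    new-sym (inj₁ (p≡x , q≡y)) = inj₂ (q≡y , p≡x)
    new-sym (inj₂ (p≡y , q≡x)) = inj₁ (q≡x , p≡y)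

    new-irrefl : ∀ {p} → ¬ NewEdge p p
    new-irrefl (inj₁ (p≡x , p≡y)) = x≢y (trans (sym p≡x) p≡y)
    new-irrefl (inj₂ (p≡y , p≡x)) = x≢y (trans (sym p≡x) p≡y)

    new-between : ∀ {p q} → p ≡ x ⊎ p ≡ y → q ≡ x ⊎ q ≡ y → p ≢ q → NewEdge p q
    new-between (inj₁ refl) (inj₁ refl) p≢q = ⊥-elim (p≢q refl)
    new-between (inj₁ refl) (inj₂ refl) _   = inj₁ (refl , refl)
    new-between (inj₂ refl) (inj₁ refl) _   = inj₂ (refl , refl)
    new-between (inj₂ refl) (inj₂ refl) p≢q = ⊥-elim (p≢q refl)

    new-via-t : ∀ {p q} → NewEdge p q → Edge G p t × Edge G t q
    new-via-t (inj₁ (refl , refl)) = ext , edge-sym G eyt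
    new-via-t (inj₂ (refl , refl)) = eyt , edge-sym G ext

    new-meets : ∀ {b c p q} → NewEdge b c → NewEdge p q → p ≡ b ⊎ q ≡ b
    new-meets (inj₁ (refl , refl)) (inj₁ (refl , refl)) = inj₁ refl
    new-meets (inj₁ (refl , refl)) (inj₂ (refl , refl)) = inj₂ refl
    new-meets (inj₂ (refl , refl)) (inj₁ (refl , refl)) = inj₂ refl
    new-meets (inj₂ (refl , refl)) (inj₂ (refl , refl)) = inj₁ refl

    new-functional : ∀ {b u a} → NewEdge b u → NewEdge b a → u ≡ a
    new-functional (inj₁ (refl , refl)) (inj₁ (_ , refl))  = refl
    new-functional (inj₁ (refl , refl)) (inj₂ (x≡y , _))   = ⊥-elim (x≢y x≡y)
    new-functional (inj₂ (refl , refl)) (inj₁ (y≡x , _))   = ⊥-elim (x≢y (sym y≡x))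
    new-functional (inj₂ (refl , refl)) (inj₂ (_ , refl))  = refl

    -- xy is not already an edge of T, as T has no detour at t
    no-edge-xy : ¬ Edge G x y
    no-edge-xy e = tree-no-detour tree
      (t , x , y , tt , x≢y , edge-sym G ext , edge-sym G eyt ,
       step (tt , edge-irrefl G ext) e (here (tt , edge-irrefl G eyt)))

    H : Graph n
    H = record
      { adj        = λ p q → adj G p q ∨ isYes (new? p q)
      ; adj-sym    = λ p q → cong₂ _∨_ (adj-sym G p q) (isYes-sym p q)
      ; adj-irrefl = λ p → cong₂ _∨_ (adj-irrefl G p)
                             (trans (isYes≗does (new? p p)) (dec-false (new? p p) new-irrefl)) }
      where
      isYes-sym : ∀ p q → isYes (new? p q) ≡ isYes (new? q p)
      isYes-sym p q = trans (isYes≗does (new? p q))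
        (trans (does-⇔ (mk⇔ new-sym new-sym) (new? p q) (new? q p)) (sym (isYes≗does (new? q p))))

    edge-H : ∀ {p q} → Edge H p q → Edge G p q ⊎ NewEdge p q
    edge-H {p} {q} e with Equivalence.to (T-∨ {adj G p q} {isYes (new? p q)}) e
    ... | inj₁ old = inj₁ old
    ... | inj₂ new = inj₂ (toWitness new)

    edge-old : ∀ {p q} → Edge G p q → Edge H p q
    edge-old {p} {q} e = Equivalence.from (T-∨ {adj G p q} {isYes (new? p q)}) (inj₁ e)

    edge-new : ∀ {p q} → NewEdge p q → Edge H p q
    edge-new {p} {q} e = Equivalence.from (T-∨ {adj G p q} {isYes (new? p q)}) (inj₂ (fromWitness e))

    k : Fin n → Bool
    k z = isYes (¬? (z ≟ᶠ t))

    open Enumerate k public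

    to-K : ∀ {z} → K z → z ≢ t
    to-K = toWitness

    from-K : ∀ {z} → z ≢ t → K z
    from-K = fromWitness

    -- A T-walk between nodes other than t becomes an H-walk avoiding t: a
    -- visit p → t → p″ to t is skipped if p = p″ and replaced by the new
    -- edge otherwise.
    shortcut : ∀ {p q} → WalkIn G (λ _ → ⊤) p q → p ≢ t → q ≢ t → WalkIn H K p q
    shortcut (here _) p≢t _ = here (from-K p≢t)
    shortcut {p} (step {y = p′} _ e w) p≢t q≢t with p′ ≟ᶠ t
    ... | no p′≢t = step (from-K p≢t) (edge-old e) (shortcut w p′≢t q≢t)
    shortcut (step _ e (here _)) p≢t q≢t | yes refl = ⊥-elim (q≢t refl)
    shortcut {p} (step _ e (step {y = p″} _ e′ w)) p≢t q≢t | yes refl with p ≟ᶠ p″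
    ... | yes refl = shortcut w p≢t q≢t
    ... | no p≢p″ =
      step (from-K p≢t) (edge-new (new-between (neighbours p e) (neighbours p″ (edge-sym G e′)) p≢p″))
           (shortcut w (≢-sym (edge-irrefl G e′)) q≢t)

    -- Conversely an H-walk becomes a T-walk by routing new edges through t;
    -- R t must hold whenever the walk uses a new edge.
    route : ∀ {Q R : Pred (Fin n) 0ℓ} → (∀ {z} → Q z → R z) →
            (∀ {p q} → Q p → Q q → NewEdge p q → R t) →
            ∀ {u a} → WalkIn H Q u a → WalkIn G R u a
    route f g (here p) = here (f p)
    route f g (step p e w) with edge-H e
    ... | inj₁ old = step (f p) old (route f g w)
    ... | inj₂ new = let (e₁ , e₂) = new-via-t new
                     in step (f p) e₁ (step (g p (Walk.first w) new) e₂ (route f g w))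

    -- a walk avoiding an endpoint b of the new edge uses no new edge
    avoids-new : ∀ {b c} → NewEdge b c → ∀ {p q} → K p × p ≢ b → K q × q ≢ b → NewEdge p q → ⊤ × t ≢ t
    avoids-new bc (_ , p≢b) (_ , q≢b) pq with new-meets bc pq
    ... | inj₁ p≡b = ⊥-elim (p≢b p≡b)
    ... | inj₂ q≡b = ⊥-elim (q≢b q≡b)

    -- a detour of H inside K yields a detour of T (at b, or at t if one of
    -- the two edges at b is new)
    no-detour : ¬ DetourIn H K
    no-detour (b , u , a , kb , u≢a , ebu , eba , w) with edge-H ebu | edge-H eba
    ... | inj₁ gbu | inj₁ gba = tree-no-detour tree
          (b , u , a , tt , u≢a , gbu , gba , route (λ q → tt , proj₂ q) (λ _ _ _ → tt , ≢-sym (to-K kb)) w)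
    ... | inj₂ nbu | inj₁ gba = let (ebt , etu) = new-via-t nbu in tree-no-detour tree
          (t , b , u , tt , edge-irrefl H ebu , edge-sym G ebt , etu ,
           step (tt , to-K kb) gba (Walk.reverse (route (λ q → tt , to-K (proj₁ q)) (avoids-new nbu) w)))
    ... | inj₁ gbu | inj₂ nba = let (ebt , eta) = new-via-t nba in tree-no-detour tree
          (t , b , a , tt , edge-irrefl H eba , edge-sym G ebt , eta ,
           step (tt , to-K kb) gbu (route (λ q → tt , to-K (proj₁ q)) (avoids-new nba) w))
    ... | inj₂ nbu | inj₂ nba = u≢a (new-functional nbu nba)

    merge : Fin n → Maybe (Fin n)
    merge z with z ≟ᶠ t
    ... | yes _ = just y
    ... | no  _ = just z

    merge-own : ∀ w → K w → merge w ≡ just w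
    merge-own w kw with w ≟ᶠ t
    ... | yes _ = ⊥-elim kw
    ... | no  _   = refl

    merge-t : merge t ≡ just y
    merge-t with t ≟ᶠ t
    ... | yes _   = refl
    ... | no  t≢t = ⊥-elim (t≢t refl)

    merge-just : ∀ z w → merge z ≡ just w → z ≡ w ⊎ (z ≡ t × w ≡ y)
    merge-just z w eq with z ≟ᶠ t
    merge-just z w refl | yes z≡t = inj₂ (z≡t , refl)
    merge-just z w refl | no  _   = inj₁ refl

    merge-connected : ∀ w → K w → ConnectedIn G (λ z → merge z ≡ just w)
    merge-connected w _ z z′ pz pz′ with merge-just z w pz | merge-just z′ w pz′
    ... | inj₁ refl          | inj₁ refl          = here pz′
    ... | inj₁ refl          | inj₂ (refl , refl) = step pz eyt (here pz′)
    ... | inj₂ (refl , refl) | inj₁ refl          = step pz (edge-sym G eyt) (here pz′)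
    ... | inj₂ (refl , refl) | inj₂ (refl , _)    = here pz′

    representative : Fin n → Fin n → Fin n × Fin n
    representative p q with (p ≟ᶠ x) ×-dec (q ≟ᶠ y) | (p ≟ᶠ y) ×-dec (q ≟ᶠ x)
    ... | yes _ | _     = x , t
    ... | no _  | yes _ = t , x
    ... | no _  | no _  = p , q

    representative-old : ∀ {p q} → Edge G p q → representative p q ≡ (p , q)
    representative-old {p} {q} e with (p ≟ᶠ x) ×-dec (q ≟ᶠ y) | (p ≟ᶠ y) ×-dec (q ≟ᶠ x)
    ... | yes (refl , refl) | _                  = ⊥-elim (no-edge-xy e)
    ... | no _              | yes (refl , refl)  = ⊥-elim (no-edge-xy (edge-sym G e))
    ... | no _              | no _               = refl

    representative-xy : representative x y ≡ (x , t)
    representative-xy with (x ≟ᶠ x) ×-dec (y ≟ᶠ y)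
    ... | yes _  = refl
    ... | no  ne = ⊥-elim (ne (refl , refl))

    representative-yx : representative y x ≡ (t , x)
    representative-yx with (y ≟ᶠ x) ×-dec (x ≟ᶠ y) | (y ≟ᶠ y) ×-dec (x ≟ᶠ x)
    ... | yes (y≡x , _) | _     = ⊥-elim (x≢y (sym y≡x))
    ... | no _          | yes _ = refl
    ... | no _          | no ne = ⊥-elim (ne (refl , refl))

    εˢ εᵗ : Fin n → Fin n → Fin n
    εˢ p q = proj₁ (representative p q)
    εᵗ p q = proj₂ (representative p q)

    ε-edge : ∀ p q → K p → K q → Edge H p q →
             Edge G (εˢ p q) (εᵗ p q) × merge (εˢ p q) ≡ just p × merge (εᵗ p q) ≡ just q
    ε-edge p q kp kq e with edge-H e
    ... | inj₁ old rewrite representative-old old = old , merge-own p kp , merge-own q kq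
    ... | inj₂ (inj₁ (refl , refl)) rewrite representative-xy = ext , merge-own x kp , merge-t
    ... | inj₂ (inj₂ (refl , refl)) rewrite representative-yx = edge-sym G ext , merge-t , merge-own x kq

    ε-flip : ∀ p q → K p → K q → Edge H p q → εˢ q p ≡ εᵗ p q × εᵗ q p ≡ εˢ p q
    ε-flip p q _ _ e with edge-H e
    ... | inj₁ old rewrite representative-old old | representative-old (edge-sym G old) = refl , refl
    ... | inj₂ (inj₁ (refl , refl)) rewrite representative-xy | representative-yx = refl , refl
    ... | inj₂ (inj₂ (refl , refl)) rewrite representative-xy | representative-yx = refl , refl

    minor-data : Induced.MinorData 𝕊 τ H k
    minor-data = record
      { nonempty         = x , from-K (edge-irrefl G ext)
      ; connected        = λ p q kp kq → shortcut (proj₁ (proj₂ isTree) p q tt tt) (to-K kp) (to-K kq)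
      ; no-detour        = no-detour
      ; branch           = merge
      ; branch-own       = merge-own
      ; branch-connected = merge-connected
      ; εˢ               = εˢ
      ; εᵗ               = εᵗ
      ; ε-edge           = ε-edge
      ; ε-flip           = ε-flip }

    open Induced.Minor 𝕊 τ H k minor-data public

    smaller : m <ℕ n
    smaller = m<n t (λ kt → to-K kt refl)

    label : Fin n → Fin n → Sep
    label p q = α (εˢ p q) (εᵗ p q)

    label-old : ∀ {p q} → Edge G p q → label p q ≡ α p q
    label-old e rewrite representative-old e = refl

    label-xy : label x y ≡ α t y
    label-xy rewrite representative-xy = αxt≡αty

    label-yx : label y x ≡ α t x
    label-yx rewrite representative-yx = refl

    incoming-H→G : ∀ v s → ∃[ z ] (K z × Edge H z v × label z v ≡ s) → αF 𝕊 τ v s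
    incoming-H→G v s (z , _ , e , eq) with edge-H e
    ... | inj₁ old                  = z , old , trans (sym (label-old old)) eq
    ... | inj₂ (inj₁ (refl , refl)) = t , edge-sym G eyt , trans (sym label-xy) eq
    ... | inj₂ (inj₂ (refl , refl)) = t , edge-sym G ext , trans (sym label-yx) eq

    incoming-G→H : ∀ v s → αF 𝕊 τ v s → ∃[ z ] (K z × Edge H z v × label z v ≡ s)
    incoming-G→H v s (z , e , eq) with z ≟ᶠ t
    ... | no z≢t = z , from-K z≢t , edge-old e , trans (label-old e) eq
    ... | yes refl with neighbours v (edge-sym G e)
    ...   | inj₁ refl = y , from-K (edge-irrefl G eyt) , edge-new (inj₂ (refl , refl)) , trans label-yx eq
    ...   | inj₂ refl = x , from-K (edge-irrefl G ext) , edge-new (inj₁ (refl , refl)) , trans label-xy eq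

    incoming⊆ : ∀ i s → αF 𝕊 τ′ i s → αF 𝕊 τ (embed i) s
    incoming⊆ i s p = incoming-H→G (embed i) s (αF′→ i s p)

    incoming⊇ : ∀ i s → αF 𝕊 τ (embed i) s → αF 𝕊 τ′ i s
    incoming⊇ i s p = αF′← i s (incoming-G→H (embed i) s p)

-- Stars and trivial separations

module _ (𝕊 : SeparationSystem) where
  open SeparationSystem 𝕊

  -- This is why a non-tight node of a tree over stars
  -- has, up to trivial separations, only two incoming separations.
  star-third-trivial : ∀ {F} → IsStar F → ∀ {r s} → F r → F s → F (s *) →
                       r ≢ s → r ≢ s * → Trivial r
  star-third-trivial (_ , star) {r} {s} Fr Fs Fs* r≢s r≢s* =
    s , (subst (r ≤_) (involutive s) (star r (s *) Fr Fs* r≢s*) , r≢s) , (star r s Fr Fs r≢s , r≢s*)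

  irredundant-injective : ∀ (τ : STree 𝕊) → Irredundant 𝕊 τ →
    let open STree τ in ∀ {t w w′} → Edge graph w t → Edge graph w′ t → α w t ≡ α w′ t → w ≡ w′
  irredundant-injective τ irred {t} {w} {w′} e e′ eq with w ≟ᶠ w′
  ... | yes w≡w′ = w≡w′
  ... | no  w≢w′ = ⊥-elim (irred (t , w , w′ , w≢w′ , edge-sym graph e , edge-sym graph e′ ,
          trans (α-flip w t e) (trans (cong _* eq) (sym (α-flip w′ t e′)))))
    where open STree τ

-- The reduction to an essential tree

module Reduction (lem : ∀ {ℓ} → ExcludedMiddle ℓ) (𝕊 : SeparationSystem)
                 (𝓕 : Pred (Pred (SeparationSystem.Sep 𝕊) 0ℓ) 0ℓ)
                 (stars : ∀ F → 𝓕 F → SeparationSystem.IsStar 𝕊 F) where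
  open SeparationSystem 𝕊

  NearlyIn𝓕 : Pred Sep 0ℓ → Set₁
  NearlyIn𝓕 X = Σ (Pred Sep 0ℓ) λ F → 𝓕 F × (∀ s → ¬ Trivial s → (X s → F s) × (F s → X s))

  NearlyOver : STree 𝕊 → Set₁
  NearlyOver τ = ∀ t → NearlyIn𝓕 (αF 𝕊 τ t)

  nearly-transfer : ∀ {X Y} → (∀ s → X s → Y s) → (∀ s → ¬ Trivial s → Y s → X s) →
                    NearlyIn𝓕 Y → NearlyIn𝓕 X
  nearly-transfer X⊆Y Y⊆X (F , 𝓕F , agree) =
    F , 𝓕F , λ s ns → (λ x → proj₁ (agree s ns) (X⊆Y s x)) , (λ f → Y⊆X s ns (proj₂ (agree s ns) f))

  LabelledMinor : STree 𝕊 → STree 𝕊 → Set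
  LabelledMinor τ′ τ = Σ (MinorWithEdges (STree.tree τ′) (STree.tree τ)) λ μ →
    ∀ t₁ t₂ → Edge (STree.graph τ′) t₁ t₂ →
      STree.α τ′ t₁ t₂ ≡ STree.α τ (MinorWithEdges.εˢ μ t₁ t₂) (MinorWithEdges.εᵗ μ t₁ t₂)

  labelled-minor-trans : ∀ {τ₂ τ₁ τ} → LabelledMinor τ₂ τ₁ → LabelledMinor τ₁ τ → LabelledMinor τ₂ τ
  labelled-minor-trans (μ₂ , labels₂) (μ₁ , labels₁) =
    compose μ₂ μ₁ , λ t₁ t₂ e → trans (labels₂ t₁ t₂ e) (labels₁ _ _ (proj₁ (MinorWithEdges.ε-edge μ₂ t₁ t₂ e)))

  Result : STree 𝕊 → Set₁
  Result τ = Σ (STree 𝕊) λ τ′ → Essential 𝕊 τ′ × OverSTree 𝕊 τ′ (EssentialCore 𝓕) × LabelledMinor τ′ τ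

  Reduct : STree 𝕊 → Set₁
  Reduct τ = Σ (STree 𝕊) λ τ′ → STree.size τ′ <ℕ STree.size τ × NearlyOver τ′ × LabelledMinor τ′ τ

  module _ (τ : STree 𝕊) where
    open STree τ renaming (size to n; graph to G)

    TrivialEdge : Set
    TrivialEdge = ∃[ x ] ∃[ y ] (Edge G x y × Trivial (α x y))

    Redundancy : Set
    Redundancy = ∃[ t ] ∃[ t′ ] ∃[ t″ ] (t′ ≢ t″ × Edge G t t′ × Edge G t t″ × α t t′ ≡ α t t″)

    Looseness : Set
    Looseness = ∃[ t ] ∃[ s ] (αF 𝕊 τ t s × αF 𝕊 τ t (s *) × s ≢ (s *))

    reduce-trivial : NearlyOver τ → TrivialEdge → Reduct τ
    reduce-trivial nearly (x , y , e , trivial) = D.τ′ , D.smaller , nearly′ , D.μ , λ _ _ _ → refl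
      where
      module D = DeleteBranch lem 𝕊 τ y x (edge-sym G e)
      lost-trivial : ∀ i s → ¬ Trivial s → αF 𝕊 τ (D.embed i) s → αF 𝕊 D.τ′ i s
      lost-trivial i s ns p with D.incoming⊇ i s p
      ... | inj₁ p′           = p′
      ... | inj₂ (_ , refl)   = ⊥-elim (ns trivial)
      nearly′ : NearlyOver D.τ′
      nearly′ i = nearly-transfer (D.incoming⊆ i) (lost-trivial i) (nearly (D.embed i))

    -- α(t,t′) = α(t,t″): delete the branch at t behind t′; the separation
    -- t loses is still sent by t″
    reduce-redundant : NearlyOver τ → Redundancy → Reduct τ
    reduce-redundant nearly (t , t′ , t″ , t′≢t″ , e′ , e″ , same) = D.τ′ , D.smaller , nearly′ , D.μ , λ _ _ _ → refl
      where
      module D = DeleteBranch lem 𝕊 τ t t′ e′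
      t″-kept : D.K t″
      t″-kept = D.from-side (step (≢-sym t′≢t″) (edge-sym G e″) (here (edge-irrefl G e′)))
      t″-sends : α t″ t ≡ α t′ t
      t″-sends = trans (α-flip t t″ e″) (trans (cong _* (sym same)) (sym (α-flip t t′ e′)))
      lost-resent : ∀ i s → ¬ Trivial s → αF 𝕊 τ (D.embed i) s → αF 𝕊 D.τ′ i s
      lost-resent i s _ p with D.incoming⊇ i s p
      ... | inj₁ p′ = p′
      ... | inj₂ (i≡t , refl) = D.αF′← i s (t″ , t″-kept , subst (Edge G t″) (sym i≡t) (edge-sym G e″) ,
                                   subst (λ r → α t″ r ≡ α t′ t) (sym i≡t) t″-sends)
      nearly′ : NearlyOver D.τ′
      nearly′ i = nearly-transfer (D.incoming⊆ i) (lost-resent i) (nearly (D.embed i))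

    -- s, s* ∈ α(F⃗ₜ), sent by x and y: in the absence of trivial edges and
    -- redundancy, x and y are the only neighbours of t, so t is suppressed
    reduce-loose : NearlyOver τ → ¬ TrivialEdge → ¬ Redundancy → Looseness → Reduct τ
    reduce-loose nearly no-trivial no-redundancy (t , s , (x , ext , αxt≡s) , (y , eyt , αyt≡s*) , s≢s*) =
      S.τ′ , S.smaller , nearly′ , S.μ , λ _ _ _ → refl
      where
      F : Pred Sep 0ℓ
      F = proj₁ (nearly t)
      agree : ∀ s → ¬ Trivial s → (αF 𝕊 τ t s → F s) × (F s → αF 𝕊 τ t s)
      agree = proj₂ (proj₂ (nearly t))
      incoming-in-F : ∀ {w} → Edge G w t → F (α w t)
      incoming-in-F {w} e = proj₁ (agree _ (λ tr → no-trivial (w , t , e , tr))) (w , e , refl)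
      injective : ∀ {w w′} → Edge G w t → Edge G w′ t → α w t ≡ α w′ t → w ≡ w′
      injective = irredundant-injective 𝕊 τ no-redundancy
      neighbours : ∀ w → Edge G w t → w ≡ x ⊎ w ≡ y
      neighbours w e with lem {P = α w t ≡ s} | lem {P = α w t ≡ s *}
      ... | yes αwt≡s | _          = inj₁ (injective e ext (trans αwt≡s (sym αxt≡s)))
      ... | no _      | yes αwt≡s* = inj₂ (injective e eyt (trans αwt≡s* (sym αyt≡s*)))
      ... | no αwt≢s  | no αwt≢s*  = ⊥-elim (no-trivial (w , t , e ,
            star-third-trivial 𝕊 (stars F (proj₁ (proj₂ (nearly t)))) (incoming-in-F e)
              (subst F αxt≡s (incoming-in-F ext)) (subst F αyt≡s* (incoming-in-F eyt)) αwt≢s αwt≢s*))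
      x≢y : x ≢ y
      x≢y refl = s≢s* (trans (sym αxt≡s) αyt≡s*)
      αxt≡αty : α x t ≡ α t y
      αxt≡αty = trans αxt≡s (trans (sym (involutive s)) (sym (trans (α-flip y t eyt) (cong _* αyt≡s*))))
      module S = Suppress.At 𝕊 τ t x y ext eyt x≢y neighbours αxt≡αty
      nearly′ : NearlyOver S.τ′
      nearly′ i = nearly-transfer (S.incoming⊆ i) (λ s _ → S.incoming⊇ i s) (nearly (S.embed i))

    irreducible : NearlyOver τ → ¬ TrivialEdge → ¬ Redundancy → ¬ Looseness → Result τ
    irreducible nearly no-trivial no-redundancy no-looseness =
      τ , (no-redundancy , no-looseness , λ x y e tr → no-trivial (x , y , e , tr)) ,
      over-core , minor-refl tree , λ _ _ _ → refl
      where
      over-core : OverSTree 𝕊 τ (EssentialCore 𝓕)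
      over-core t = αF 𝕊 τ t ,
        (F , 𝓕F , λ s → mk⇔ (λ p → proj₁ (agree s (nontrivial s p)) p , nontrivial s p)
                            (λ (f , ns) → proj₂ (agree s ns) f)) ,
        λ s → mk⇔ (λ p → p) (λ p → p)
        where
        F : Pred Sep 0ℓ
        F = proj₁ (nearly t)
        𝓕F : 𝓕 F
        𝓕F = proj₁ (proj₂ (nearly t))
        agree : ∀ s → ¬ Trivial s → (αF 𝕊 τ t s → F s) × (F s → αF 𝕊 τ t s)
        agree = proj₂ (proj₂ (nearly t))
        nontrivial : ∀ s → αF 𝕊 τ t s → ¬ Trivial s
        nontrivial s (x , e , refl) tr = no-trivial (x , t , e , tr)

  after-reduction : ∀ {τ} → (∀ τ₁ → STree.size τ₁ <ℕ STree.size τ → NearlyOver τ₁ → Result τ₁) →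
                    Reduct τ → Result τ
  after-reduction {τ} ih (τ₁ , τ₁<τ , nearly₁ , μ₁) =
    let (τ′ , essential , over-core , μ′) = ih τ₁ τ₁<τ nearly₁
    in τ′ , essential , over-core , labelled-minor-trans {τ′} {τ₁} {τ} μ′ μ₁

  reduce : ∀ τ → Acc _<ℕ_ (STree.size τ) → NearlyOver τ → Result τ
  reduce τ (acc below) nearly with lem {P = TrivialEdge τ} | lem {P = Redundancy τ} | lem {P = Looseness τ}
  ... | yes triv   | _         | _           = after-reduction {τ} (λ τ₁ τ₁<τ → reduce τ₁ (below τ₁<τ)) (reduce-trivial τ nearly triv)
  ... | no no-triv | yes red   | _           = after-reduction {τ} (λ τ₁ τ₁<τ → reduce τ₁ (below τ₁<τ)) (reduce-redundant τ nearly red)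
  ... | no no-triv | no no-red | yes loose   = after-reduction {τ} (λ τ₁ τ₁<τ → reduce τ₁ (below τ₁<τ)) (reduce-loose τ nearly no-triv no-red loose)
  ... | no no-triv | no no-red | no no-loose = irreducible τ nearly no-triv no-red no-loose

  over→nearly : ∀ τ → OverSTree 𝕊 τ 𝓕 → NearlyOver τ
  over→nearly τ over t with over t
  ... | F , 𝓕F , F≐αF = F , 𝓕F , λ s _ → Equivalence.from (F≐αF s) , Equivalence.to (F≐αF s)

corollary6p7 : (∀ {ℓ} → ExcludedMiddle ℓ) →
    (𝕊 : SeparationSystem) →
    let open SeparationSystem 𝕊 in
    (𝓕 : Pred (Pred Sep 0ℓ) 0ℓ) → (∀ F → 𝓕 F → IsStar F) →
    (τ : STree 𝕊) → OverSTree 𝕊 τ 𝓕 →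
    Σ (STree 𝕊) λ τ' →
      Essential 𝕊 τ' × OverSTree 𝕊 τ' (EssentialCore 𝓕)
      × Σ (MinorWithEdges (STree.tree τ') (STree.tree τ)) λ μ →
          ∀ t₁ t₂ → Edge (STree.graph τ') t₁ t₂ →
            STree.α τ' t₁ t₂
              ≡ STree.α τ (MinorWithEdges.εˢ μ t₁ t₂) (MinorWithEdges.εᵗ μ t₁ t₂)
corollary6p7 lem 𝕊 𝓕 stars τ over =
  reduce τ (<-wellFounded (STree.size τ)) (over→nearly τ over)
  where open Reduction lem 𝕊 𝓕 stars
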